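{- Let $p$ be a prime and $G$ a profinite group acting trivially on $\mathbb{Z}/p$. Let $\chi_1,\chi_2,\chi_3\in H^1(G)$. Suppose that the triple Massey product $\langle\chi_1,\chi_2,\chi_3\rangle$ is defined (i.e. nonempty), and that the cup product--restriction property holds for $\chi_1,\chi_3$. Then $0\in\langle\chi_1,\chi_2,\chi_3\rangle$.
   Context: $H^i(G)=H^i(G,\mathbb{Z}/p)$ is the cohomology of the differential graded algebra $C^\bullet=\bigoplus_s C^s(G,\mathbb{Z}/p)$ of continuous inhomogeneous cochains with the cup product and differential $\partial$. Triple Massey product: given $\chi_1,\chi_2,\chi_3\in H^1(G)$, a defining system consists of $1$-cochains $c_{11},c_{22},c_{33},c_{12},c_{23}\in C^1$ with $c_{ii}$ a cocycle representing $\chi_i$ and $\partial c_{ij}=\tilde c_{ij}$ for $(i,j)\in\{(1,1),(2,2),(3,3),(1,2),(2,3)\}$, where $\tilde c_{ij}=-\sum_{r=i}^{j-1}c_{ir}\cup c_{r+1,j}$ (so $\tilde c_{ii}=0$). Then $\tilde c_{13}=-(c_{11}\cup c_{23}+c_{12}\cup c_{33})$ is a $2$-cocycle, and $\langle\chi_1,\chi_2,\chi_3\rangle\subseteq H^2(G)$ is the set of classes $[\tilde c_{13}]$ over all defining systems. For $\chi_1,\ldots,\chi_r\in H^1(G)$ with $K=\bigcap_i\mathrm{Ker}(\chi_i)$, the cup product--restriction property holds for $\chi_1,\ldots,\chi_r$ if $\mathrm{Ker}(\mathrm{res}_K\colon H^2(G)\to H^2(K))=\chi_1\cup H^1(G)+\cdots+\chi_r\cup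 H^1(G)$. -}

module Defs where

open import Data.Nat using (ℕ; _+_; _*_; _∸_; NonZero)
open import Data.Nat.DivMod using (_mod_)
open import Data.Nat.Primality using (Prime; prime⇒nonZero)
open import Data.Fin using (Fin; toℕ)
open import Data.Product using (Σ; ∃; ∃-syntax; _×_; _,_)
open import Data.List using (List)
open import Data.List.Membership.Propositional using (_∈_)
open import Relation.Binary.PropositionalEquality using (_≡_)
open import Algebra.Structures using (IsGroup)

-- A profinite group, presented as a (Hausdorff, complete) group whose
-- topology has as a basis of neighbourhoods of 1 a filter base of
-- normal subgroups of finite index ("open normal subgroups").
-- Topology on G: U is open iff for every g ∈ U there is i with g·N i ⊆ U.
record ProfiniteGroup : Set₁ where
  field
    Carrier : Set
    _∙_     : Carrier → Carrier → Carrier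
    ε       : Carrier
    _⁻¹     : Carrier → Carrier
    isGroup : IsGroup _≡_ _∙_ ε _⁻¹
    Idx     : Set
    N       : Idx → Carrier → Set
    inhabited : Idx
    N-ε     : ∀ i → N i ε
    N-∙     : ∀ i {x y} → N i x → N i y → N i (x ∙ y)
    N-⁻¹    : ∀ i {x} → N i x → N i (x ⁻¹)
    N-normal : ∀ i g {x} → N i x → N i ((g ∙ x) ∙ (g ⁻¹))
    N-finiteIndex : ∀ i → Σ (List Carrier) λ reps →
                      ∀ g → ∃[ r ] (r ∈ reps × N i ((r ⁻¹) ∙ g))
    N-meet  : ∀ i j → ∃[ k ] (∀ x → N k x → N i x × N j x)
    hausdorff : ∀ g → (∀ i → N i g) → g ≡ ε
    -- complete: G → lim G/N i is surjective
    complete : (x : Idx → Carrier) →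
               (∀ i j → (∀ y → N j y → N i y) → N i ((x i ⁻¹) ∙ x j)) →
               ∃[ g ] (∀ i → N i ((x i ⁻¹) ∙ g))

-- Continuous inhomogeneous cochains of G with values in ℤ/p (trivial action),
-- in the degrees needed for a triple Massey product.
module Cochains (p : ℕ) (pp : Prime p) (G : ProfiniteGroup) where
  instance
    p≢0 : NonZero p
    p≢0 = prime⇒nonZero pp

  open ProfiniteGroup G

  ℤ/p : Set
  ℤ/p = Fin p

  0ₚ : ℤ/p
  0ₚ = 0 mod p

  _+ₚ_ : ℤ/p → ℤ/p → ℤ/p
  a +ₚ b = (toℕ a + toℕ b) mod p

  _*ₚ_ : ℤ/p → ℤ/p → ℤ/p
  a *ₚ b = (toℕ a * toℕ b) mod p

  -ₚ_ : ℤ/p → ℤ/p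
  -ₚ a = (p ∸ toℕ a) mod p

  _-ₚ_ : ℤ/p → ℤ/p → ℤ/p
  a -ₚ b = a +ₚ (-ₚ b)

  infixl 6 _+ₚ_ _-ₚ_
  infixl 7 _*ₚ_

  C⁰ C¹ C² : Set
  C⁰ = ℤ/p
  C¹ = Carrier → ℤ/p
  C² = Carrier → Carrier → ℤ/p

  -- continuity (ℤ/p discrete, G^n with product topology)
  Cont¹ : C¹ → Set
  Cont¹ f = ∀ g → ∃[ i ] (∀ h → N i ((g ⁻¹) ∙ h) → f h ≡ f g)

  Cont² : C² → Set
  Cont² f = ∀ g₁ g₂ → ∃[ i ] (∀ h₁ h₂ → N i ((g₁ ⁻¹) ∙ h₁) → N i ((g₂ ⁻¹) ∙ h₂)
                                  → f h₁ h₂ ≡ f g₁ g₂)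

  ∂⁰ : C⁰ → C¹
  ∂⁰ a g = a -ₚ a

  ∂¹ : C¹ → C²
  ∂¹ c g h = (c h -ₚ c (g ∙ h)) +ₚ c g

  ∂² : C² → Carrier → Carrier → Carrier → ℤ/p
  ∂² c g h k = ((c h k -ₚ c (g ∙ h) k) +ₚ c g (h ∙ k)) -ₚ c g h

  _∪_ : C¹ → C¹ → C²
  (a ∪ b) g h = a g *ₚ b h

  _+²_ : C² → C² → C²
  (a +² b) g h = a g h +ₚ b g h

  -ᶜ_ : C² → C²
  (-ᶜ a) g h = -ₚ (a g h)

  record Z¹ : Set where
    field
      fn      : C¹
      cont    : Cont¹ fn
      cocycle : ∀ g h → ∂¹ fn g h ≡ 0ₚ
  open Z¹ public

  Represents : C¹ → Z¹ → Set
  Represents c χ = Cont¹ c × (∀ g h → ∂¹ c g h ≡ 0ₚ)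
                   × ∃[ a ] (∀ g → c g ≡ fn χ g +ₚ ∂⁰ a g)

  IsCoboundary² : C² → Set
  IsCoboundary² c = ∃[ b ] (Cont¹ b × (∀ g h → c g h ≡ ∂¹ b g h))

  record DefiningSystem (χ₁ χ₂ χ₃ : Z¹) : Set where
    field
      c₁₁ c₂₂ c₃₃ c₁₂ c₂₃ : C¹
      rep₁ : Represents c₁₁ χ₁
      rep₂ : Represents c₂₂ χ₂
      rep₃ : Represents c₃₃ χ₃
      cont₁₂ : Cont¹ c₁₂
      cont₂₃ : Cont¹ c₂₃
      ∂c₁₂ : ∀ g h → ∂¹ c₁₂ g h ≡ (-ᶜ (c₁₁ ∪ c₂₂)) g h
      ∂c₂₃ : ∀ g h → ∂¹ c₂₃ g h ≡ (-ᶜ (c₂₂ ∪ c₃₃)) g h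

    c̃₁₃ : C²
    c̃₁₃ = -ᶜ ((c₁₁ ∪ c₂₃) +² (c₁₂ ∪ c₃₃))

  MasseyDefined : Z¹ → Z¹ → Z¹ → Set
  MasseyDefined χ₁ χ₂ χ₃ = DefiningSystem χ₁ χ₂ χ₃

  ZeroInMassey : Z¹ → Z¹ → Z¹ → Set
  ZeroInMassey χ₁ χ₂ χ₃ =
    ∃[ D ] IsCoboundary² (DefiningSystem.c̃₁₃ {χ₁} {χ₂} {χ₃} D)

  InK : Z¹ → Z¹ → Carrier → Set
  InK χ₁ χ₃ g = (fn χ₁ g ≡ 0ₚ) × (fn χ₃ g ≡ 0ₚ)

  K : Z¹ → Z¹ → Set
  K χ₁ χ₃ = Σ Carrier (InK χ₁ χ₃)

  ResTrivial : Z¹ → Z¹ → C² → Set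
  ResTrivial χ₁ χ₃ c =
    Σ (K χ₁ χ₃ → ℤ/p) λ e →
      (∀ (x : K χ₁ χ₃) → ∃[ i ] (∀ (y : K χ₁ χ₃) →
          N i ((Σ.proj₁ x ⁻¹) ∙ Σ.proj₁ y) → e y ≡ e x))
      × (∀ (x y : K χ₁ χ₃) → (xy : InK χ₁ χ₃ (Σ.proj₁ x ∙ Σ.proj₁ y)) →
           c (Σ.proj₁ x) (Σ.proj₁ y) ≡ (e y -ₚ e (Σ.proj₁ x ∙ Σ.proj₁ y , xy)) +ₚ e x)
    where open Data.Product

  InCupImage : Z¹ → Z¹ → C² → Set
  InCupImage χ₁ χ₃ c =
    ∃[ ψ₁ ] ∃[ ψ₃ ] ∃[ b ] (Cont¹ b ×
      (∀ g h → c g h ≡ ((fn χ₁ ∪ fn ψ₁) +² (fn χ₃ ∪ fn ψ₃)) g h +ₚ ∂¹ b g h))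

  CupResProperty : Z¹ → Z¹ → Set
  CupResProperty χ₁ χ₃ =
    ∀ (c : C²) → Cont² c → (∀ g h k → ∂² c g h k ≡ 0ₚ) →
      (ResTrivial χ₁ χ₃ c → InCupImage χ₁ χ₃ c)
      × (InCupImage χ₁ χ₃ c → ResTrivial χ₁ χ₃ c)

module Submission where

-- Take a defining system D.  Its Massey cochain c̃₁₃ is a continuous
-- 2-cocycle (Leibniz rule), and it vanishes identically on K = Ker χ₁ ∩ Ker χ₃
-- because c₁₁ = χ₁ and c₃₃ = χ₃ pointwise.  The cup product–restriction
-- property therefore gives cocycles ψ₁, ψ₃ and a cochain b with
-- c̃₁₃ = χ₁ ∪ ψ₁ + χ₃ ∪ ψ₃ + ∂b.  Replacing c₁₂ by c₁₂ - ψ₃ and c₂₃ by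
-- c₂₃ + ψ₁ gives a new defining system whose Massey cochain is
-- ∂b + χ₃ ∪ ψ₃ + ψ₃ ∪ χ₃ = ∂(b - χ₃·ψ₃), since χ₃ and ψ₃ are homomorphisms.

open import Algebra.Bundles using (CommutativeRing)
open import Data.Integer as ℤ using (ℤ; +_; -[1+_]; _⊖_)
open import Data.Integer.Properties using (⊖-≥; ⊖-<)
open import Data.Maybe using (Maybe; just; nothing)
open import Data.Nat as ℕ using (ℕ; suc; _∸_)
import Data.Nat.Properties as ℕₚ
open import Data.Nat.Properties using (m∸n+n≡m; <⇒≤; ≰⇒>)
open import Data.Nat.Primality using (Prime)
open import Data.Product using (∃-syntax; _,_; proj₁; proj₂)
open import Data.Sign as Sign using ()
open import Relation.Nullary using (yes; no)
open import Relation.Binary.PropositionalEquality as ≡ using (_≡_; cong)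

open import Defs

-- The unique ring morphism ℤ → R into a commutative ring R.  It lets the
-- ring solver normalise polynomial identities over R with integer
-- coefficients, which are computed by evaluation in ℤ.
module IntegerCoefficientSolver {c ℓ} (R : CommutativeRing c ℓ) where
  open CommutativeRing R
  open import Algebra.Properties.Semiring.Mult.TCOptimised semiring using (_×_; ×-homo-+; ×1-homo-*)
  open import Algebra.Properties.Ring ring using (-‿distribˡ-*; -‿distribʳ-*)
  open import Algebra.Properties.Group +-group using (ε⁻¹≈ε; ⁻¹-involutive; ⁻¹-anti-homo-∙; //-rightDividesʳ; \\-leftDividesˡ)
  open import Algebra.Properties.AbelianGroup +-abelianGroup using (⁻¹-∙-comm)
  open import Relation.Binary.Reasoning.Setoid setoid
  import Algebra.Solver.Ring.AlmostCommutativeRing as ACR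

  ⟦_⟧ : ℤ → Carrier
  ⟦ + n ⟧      = n × 1#
  ⟦ -[1+ n ] ⟧ = - (suc n × 1#)

  ⟦-⟧ : ∀ i → ⟦ ℤ.- i ⟧ ≈ - ⟦ i ⟧
  ⟦-⟧ (+ 0)      = sym ε⁻¹≈ε
  ⟦-⟧ (+ suc n)  = refl
  ⟦-⟧ -[1+ n ]   = sym (⁻¹-involutive _)

  ⟦⊖⟧ : ∀ m n → ⟦ m ⊖ n ⟧ ≈ m × 1# - n × 1#
  ⟦⊖⟧ m n with n ℕ.≤? m
  ... | yes n≤m = begin
    ⟦ m ⊖ n ⟧                          ≡⟨ cong ⟦_⟧ (⊖-≥ n≤m) ⟩
    (m ∸ n) × 1#                       ≈⟨ //-rightDividesʳ (n × 1#) _ ⟨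
    ((m ∸ n) × 1# + n × 1#) - n × 1#   ≈⟨ +-congʳ (×-homo-+ 1# (m ∸ n) n) ⟨
    (m ∸ n ℕ.+ n) × 1# - n × 1#        ≡⟨ cong (λ k → k × 1# - n × 1#) (m∸n+n≡m n≤m) ⟩
    m × 1# - n × 1#                    ∎
  ... | no n≰m = begin
    ⟦ m ⊖ n ⟧                                ≡⟨ cong ⟦_⟧ (⊖-< (≰⇒> n≰m)) ⟩
    ⟦ ℤ.- + (n ∸ m) ⟧                        ≈⟨ ⟦-⟧ (+ (n ∸ m)) ⟩
    - ((n ∸ m) × 1#)                         ≈⟨ \\-leftDividesˡ (m × 1#) _ ⟨
    m × 1# + (- (m × 1#) - (n ∸ m) × 1#)     ≈⟨ +-congˡ (⁻¹-anti-homo-∙ _ (m × 1#)) ⟨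
    m × 1# - ((n ∸ m) × 1# + m × 1#)         ≈⟨ +-congˡ (-‿cong (×-homo-+ 1# (n ∸ m) m)) ⟨
    m × 1# - (n ∸ m ℕ.+ m) × 1#              ≡⟨ cong (λ k → m × 1# - k × 1#) (m∸n+n≡m (<⇒≤ (≰⇒> n≰m))) ⟩
    m × 1# - n × 1#                          ∎

  ⟦+⟧ : ∀ i j → ⟦ i ℤ.+ j ⟧ ≈ ⟦ i ⟧ + ⟦ j ⟧
  ⟦+⟧ (+ m)    (+ n)    = ×-homo-+ 1# m n
  ⟦+⟧ (+ m)    -[1+ n ] = ⟦⊖⟧ m (suc n)
  ⟦+⟧ -[1+ m ] (+ n)    = trans (⟦⊖⟧ n (suc m)) (+-comm _ _)
  ⟦+⟧ -[1+ m ] -[1+ n ] = begin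
    - (suc (suc m ℕ.+ n) × 1#)           ≡⟨ cong (λ k → - (suc k × 1#)) (ℕₚ.+-suc m n) ⟨
    - ((suc m ℕ.+ suc n) × 1#)           ≈⟨ -‿cong (×-homo-+ 1# (suc m) (suc n)) ⟩
    - (suc m × 1# + suc n × 1#)          ≈⟨ ⁻¹-∙-comm _ _ ⟨
    - (suc m × 1#) - suc n × 1#          ∎

  ⟦+◃⟧ : ∀ n → ⟦ Sign.+ ℤ.◃ n ⟧ ≈ n × 1#
  ⟦+◃⟧ 0       = refl
  ⟦+◃⟧ (suc n) = refl

  ⟦-◃⟧ : ∀ n → ⟦ Sign.- ℤ.◃ n ⟧ ≈ - (n × 1#)
  ⟦-◃⟧ 0       = sym ε⁻¹≈ε
  ⟦-◃⟧ (suc n) = refl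

  ⟦*⟧ : ∀ i j → ⟦ i ℤ.* j ⟧ ≈ ⟦ i ⟧ * ⟦ j ⟧
  ⟦*⟧ (+ m) (+ n) = trans (⟦+◃⟧ (m ℕ.* n)) (×1-homo-* m n)
  ⟦*⟧ (+ m) -[1+ n ] = begin
    ⟦ Sign.- ℤ.◃ m ℕ.* suc n ⟧   ≈⟨ ⟦-◃⟧ (m ℕ.* suc n) ⟩
    - ((m ℕ.* suc n) × 1#)       ≈⟨ -‿cong (×1-homo-* m (suc n)) ⟩
    - (m × 1# * suc n × 1#)      ≈⟨ -‿distribʳ-* _ _ ⟩
    m × 1# * - (suc n × 1#)      ∎
  ⟦*⟧ -[1+ m ] (+ n) = begin
    ⟦ Sign.- ℤ.◃ suc m ℕ.* n ⟧   ≈⟨ ⟦-◃⟧ (suc m ℕ.* n) ⟩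
    - ((suc m ℕ.* n) × 1#)       ≈⟨ -‿cong (×1-homo-* (suc m) n) ⟩
    - (suc m × 1# * n × 1#)      ≈⟨ -‿distribˡ-* _ _ ⟩
    - (suc m × 1#) * n × 1#      ∎
  ⟦*⟧ -[1+ m ] -[1+ n ] = begin
    (suc m ℕ.* suc n) × 1#           ≈⟨ ×1-homo-* (suc m) (suc n) ⟩
    suc m × 1# * suc n × 1#          ≈⟨ ⁻¹-involutive _ ⟨
    - - (suc m × 1# * suc n × 1#)    ≈⟨ -‿cong (-‿distribʳ-* _ _) ⟩
    - (suc m × 1# * - (suc n × 1#))  ≈⟨ -‿distribˡ-* _ _ ⟩
    - (suc m × 1#) * - (suc n × 1#)  ∎

  almostCommutativeRing : ACR.AlmostCommutativeRing c ℓ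
  almostCommutativeRing = ACR.fromCommutativeRing R

  integerMorphism : ACR._-Raw-AlmostCommutative⟶_ ℤ.+-*-rawRing almostCommutativeRing
  integerMorphism = record
    { ⟦_⟧ = ⟦_⟧ ; +-homo = ⟦+⟧ ; *-homo = ⟦*⟧ ; -‿homo = ⟦-⟧ ; 0-homo = refl ; 1-homo = refl }

  coefficients≟ : ∀ i j → Maybe (⟦ i ⟧ ≈ ⟦ j ⟧)
  coefficients≟ i j with i ℤ.≟ j
  ... | yes ≡.refl = just refl
  ... | no _     = nothing

  open import Algebra.Solver.Ring ℤ.+-*-rawRing almostCommutativeRing integerMorphism coefficients≟ public
    using (solve; _:=_; _:+_; _:*_; _:-_; :-_; con)

-- ℤ/n, presented as Fin n with the operations of ℕ reduced modulo n, is a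
-- commutative ring for every n ≥ 1.  Every law is inherited from ℕ through
-- the reduction map m ↦ m mod n, which may be applied to an operand early
-- without changing the result.
module ResidueRing (n : ℕ) .{{_ : ℕ.NonZero n}} where
  open import Data.Fin using (Fin; toℕ)
  open import Data.Fin.Properties using (toℕ-injective; toℕ<n; toℕ-fromℕ<)
  open import Data.Nat.DivMod using (_mod_; _%_; m%n<n; m<n⇒m%n≡m; m%n%n≡m%n; %-distribˡ-+; %-distribˡ-*; n%n≡0; m*n%n≡0)
  open ≡ using (sym; trans; cong₂; isEquivalence)
  open ≡.≡-Reasoning

  infixl 6 _+_
  infixl 7 _*_

  reduce : ℕ → Fin n
  reduce m = m mod n

  _+_ : Fin n → Fin n → Fin n
  a + b = reduce (toℕ a ℕ.+ toℕ b)

  _*_ : Fin n → Fin n → Fin n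
  a * b = reduce (toℕ a ℕ.* toℕ b)

  -_ : Fin n → Fin n
  - a = reduce (n ∸ toℕ a)

  toℕ-reduce : ∀ m → toℕ (reduce m) ≡ m % n
  toℕ-reduce m = toℕ-fromℕ< (m%n<n m n)

  reduce-toℕ : ∀ a → reduce (toℕ a) ≡ a
  reduce-toℕ a = toℕ-injective (trans (toℕ-reduce (toℕ a)) (m<n⇒m%n≡m (toℕ<n a)))

  reduce-cong : ∀ {m k} → m % n ≡ k % n → reduce m ≡ reduce k
  reduce-cong {m} {k} eq = toℕ-injective (trans (toℕ-reduce m) (trans eq (sym (toℕ-reduce k))))

  reduce-+ˡ : ∀ m k → reduce (toℕ (reduce m) ℕ.+ k) ≡ reduce (m ℕ.+ k)
  reduce-+ˡ m k = reduce-cong (begin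
    (toℕ (reduce m) ℕ.+ k) % n       ≡⟨ cong (λ x → (x ℕ.+ k) % n) (toℕ-reduce m) ⟩
    (m % n ℕ.+ k) % n                ≡⟨ %-distribˡ-+ (m % n) k n ⟩
    (m % n % n ℕ.+ k % n) % n        ≡⟨ cong (λ x → (x ℕ.+ k % n) % n) (m%n%n≡m%n m n) ⟩
    (m % n ℕ.+ k % n) % n            ≡⟨ %-distribˡ-+ m k n ⟨
    (m ℕ.+ k) % n                    ∎)

  reduce-+ʳ : ∀ m k → reduce (m ℕ.+ toℕ (reduce k)) ≡ reduce (m ℕ.+ k)
  reduce-+ʳ m k = begin
    reduce (m ℕ.+ toℕ (reduce k))   ≡⟨ cong reduce (ℕₚ.+-comm m _) ⟩
    reduce (toℕ (reduce k) ℕ.+ m)   ≡⟨ reduce-+ˡ k m ⟩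
    reduce (k ℕ.+ m)                ≡⟨ cong reduce (ℕₚ.+-comm k m) ⟩
    reduce (m ℕ.+ k)                ∎

  reduce-*ˡ : ∀ m k → reduce (toℕ (reduce m) ℕ.* k) ≡ reduce (m ℕ.* k)
  reduce-*ˡ m k = reduce-cong (begin
    (toℕ (reduce m) ℕ.* k) % n       ≡⟨ cong (λ x → (x ℕ.* k) % n) (toℕ-reduce m) ⟩
    (m % n ℕ.* k) % n                ≡⟨ %-distribˡ-* (m % n) k n ⟩
    (m % n % n ℕ.* (k % n)) % n      ≡⟨ cong (λ x → (x ℕ.* (k % n)) % n) (m%n%n≡m%n m n) ⟩
    (m % n ℕ.* (k % n)) % n          ≡⟨ %-distribˡ-* m k n ⟨
    (m ℕ.* k) % n                    ∎)

  reduce-*ʳ : ∀ m k → reduce (m ℕ.* toℕ (reduce k)) ≡ reduce (m ℕ.* k)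
  reduce-*ʳ m k = begin
    reduce (m ℕ.* toℕ (reduce k))   ≡⟨ cong reduce (ℕₚ.*-comm m _) ⟩
    reduce (toℕ (reduce k) ℕ.* m)   ≡⟨ reduce-*ˡ k m ⟩
    reduce (k ℕ.* m)                ≡⟨ cong reduce (ℕₚ.*-comm k m) ⟩
    reduce (m ℕ.* k)                ∎

  +-assoc : ∀ a b c → (a + b) + c ≡ a + (b + c)
  +-assoc a b c = begin
    reduce (toℕ (a + b) ℕ.+ toℕ c)           ≡⟨ reduce-+ˡ (toℕ a ℕ.+ toℕ b) (toℕ c) ⟩
    reduce ((toℕ a ℕ.+ toℕ b) ℕ.+ toℕ c)     ≡⟨ cong reduce (ℕₚ.+-assoc (toℕ a) (toℕ b) (toℕ c)) ⟩
    reduce (toℕ a ℕ.+ (toℕ b ℕ.+ toℕ c))     ≡⟨ reduce-+ʳ (toℕ a) (toℕ b ℕ.+ toℕ c) ⟨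
    reduce (toℕ a ℕ.+ toℕ (b + c))           ∎

  *-assoc : ∀ a b c → (a * b) * c ≡ a * (b * c)
  *-assoc a b c = begin
    reduce (toℕ (a * b) ℕ.* toℕ c)           ≡⟨ reduce-*ˡ (toℕ a ℕ.* toℕ b) (toℕ c) ⟩
    reduce ((toℕ a ℕ.* toℕ b) ℕ.* toℕ c)     ≡⟨ cong reduce (ℕₚ.*-assoc (toℕ a) (toℕ b) (toℕ c)) ⟩
    reduce (toℕ a ℕ.* (toℕ b ℕ.* toℕ c))     ≡⟨ reduce-*ʳ (toℕ a) (toℕ b ℕ.* toℕ c) ⟨
    reduce (toℕ a ℕ.* toℕ (b * c))           ∎

  +-comm : ∀ a b → a + b ≡ b + a
  +-comm a b = cong reduce (ℕₚ.+-comm (toℕ a) (toℕ b))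

  *-comm : ∀ a b → a * b ≡ b * a
  *-comm a b = cong reduce (ℕₚ.*-comm (toℕ a) (toℕ b))

  +-identityˡ : ∀ a → reduce 0 + a ≡ a
  +-identityˡ a = trans (reduce-+ˡ 0 (toℕ a)) (reduce-toℕ a)

  +-identityʳ : ∀ a → a + reduce 0 ≡ a
  +-identityʳ a = trans (+-comm a _) (+-identityˡ a)

  *-identityˡ : ∀ a → reduce 1 * a ≡ a
  *-identityˡ a = begin
    reduce (toℕ (reduce 1) ℕ.* toℕ a)   ≡⟨ reduce-*ˡ 1 (toℕ a) ⟩
    reduce (1 ℕ.* toℕ a)                ≡⟨ cong reduce (ℕₚ.*-identityˡ (toℕ a)) ⟩
    reduce (toℕ a)                      ≡⟨ reduce-toℕ a ⟩
    a                                   ∎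

  *-identityʳ : ∀ a → a * reduce 1 ≡ a
  *-identityʳ a = trans (*-comm a _) (*-identityˡ a)

  -‿inverseˡ : ∀ a → (- a) + a ≡ reduce 0
  -‿inverseˡ a = begin
    reduce (toℕ (- a) ℕ.+ toℕ a)        ≡⟨ reduce-+ˡ (n ∸ toℕ a) (toℕ a) ⟩
    reduce (n ∸ toℕ a ℕ.+ toℕ a)        ≡⟨ cong reduce (m∸n+n≡m (<⇒≤ (toℕ<n a))) ⟩
    reduce n                            ≡⟨ reduce-cong (trans (n%n≡0 n) (sym (m*n%n≡0 0 n))) ⟩
    reduce 0                            ∎

  -‿inverseʳ : ∀ a → a + (- a) ≡ reduce 0
  -‿inverseʳ a = trans (+-comm a (- a)) (-‿inverseˡ a)

  *-distribˡ-+ : ∀ a b c → a * (b + c) ≡ a * b + a * c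
  *-distribˡ-+ a b c = begin
    reduce (toℕ a ℕ.* toℕ (b + c))                      ≡⟨ reduce-*ʳ (toℕ a) (toℕ b ℕ.+ toℕ c) ⟩
    reduce (toℕ a ℕ.* (toℕ b ℕ.+ toℕ c))                ≡⟨ cong reduce (ℕₚ.*-distribˡ-+ (toℕ a) (toℕ b) (toℕ c)) ⟩
    reduce (toℕ a ℕ.* toℕ b ℕ.+ toℕ a ℕ.* toℕ c)        ≡⟨ reduce-+ʳ (toℕ a ℕ.* toℕ b) (toℕ a ℕ.* toℕ c) ⟨
    reduce (toℕ a ℕ.* toℕ b ℕ.+ toℕ (a * c))            ≡⟨ reduce-+ˡ (toℕ a ℕ.* toℕ b) (toℕ (a * c)) ⟨
    a * b + a * c                                       ∎

  *-distribʳ-+ : ∀ a b c → (b + c) * a ≡ b * a + c * a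
  *-distribʳ-+ a b c = begin
    (b + c) * a       ≡⟨ *-comm (b + c) a ⟩
    a * (b + c)       ≡⟨ *-distribˡ-+ a b c ⟩
    a * b + a * c     ≡⟨ cong₂ _+_ (*-comm a b) (*-comm a c) ⟩
    b * a + c * a     ∎

  commutativeRing : CommutativeRing _ _
  commutativeRing = record
    { Carrier = Fin n ; _≈_ = _≡_ ; _+_ = _+_ ; _*_ = _*_ ; -_ = -_ ; 0# = reduce 0 ; 1# = reduce 1
    ; isCommutativeRing = record
      { isRing = record
        { +-isAbelianGroup = record
          { isGroup = record
            { isMonoid = record
              { isSemigroup = record
                { isMagma = record { isEquivalence = isEquivalence ; ∙-cong = cong₂ _+_ }
                ; assoc = +-assoc }
              ; identity = +-identityˡ , +-identityʳ }
            ; inverse = -‿inverseˡ , -‿inverseʳ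
            ; ⁻¹-cong = cong -_ }
          ; comm = +-comm }
        ; *-cong = cong₂ _*_
        ; *-assoc = *-assoc
        ; *-identity = *-identityˡ , *-identityʳ
        ; distrib = *-distribˡ-+ , *-distribʳ-+ }
      ; *-comm = *-comm } }

module MasseyVanishing (p : ℕ) (pp : Prime p) (G : ProfiniteGroup) where
  open ProfiniteGroup G
  open Cochains p pp G
  open IntegerCoefficientSolver (ResidueRing.commutativeRing p)
    using (solve; _:=_; _:+_; _:*_; _:-_; :-_; con)
  open ≡ using (trans; cong₂)
  open ≡.≡-Reasoning

  LocallyConstant : {A : Set} → (Carrier → A) → Set
  LocallyConstant f = ∀ g → ∃[ i ] (∀ h → N i ((g ⁻¹) ∙ h) → f h ≡ f g)

  -- the pairing of two locally constant maps is locally constant, since the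
  -- basic subgroups form a filter base
  locallyConstant-pair : {A B : Set} {u : Carrier → A} {v : Carrier → B} →
    LocallyConstant u → LocallyConstant v → LocallyConstant (λ x → u x , v x)
  locallyConstant-pair cu cv g with cu g | cv g
  ... | i , ui | j , vj with N-meet i j
  ... | k , k⊆ = k , λ h hk → cong₂ _,_ (ui h (proj₁ (k⊆ _ hk))) (vj h (proj₂ (k⊆ _ hk)))

  Cont¹-pointwise : {c d : C¹} (op : ℤ/p → ℤ/p → ℤ/p) →
    Cont¹ c → Cont¹ d → Cont¹ (λ x → op (c x) (d x))
  Cont¹-pointwise op cc cd g with locallyConstant-pair cc cd g
  ... | i , cdi = i , λ h hi → cong (λ (a , b) → op a b) (cdi h hi)

  Cont²-separated : {A B : Set} {u : Carrier → A} {v : Carrier → B}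
    (F : A → B → ℤ/p) → LocallyConstant u → LocallyConstant v →
    Cont² (λ x y → F (u x) (v y))
  Cont²-separated F cu cv g₁ g₂ with cu g₁ | cv g₂
  ... | i , ui | j , vj with N-meet i j
  ... | k , k⊆ = k , λ h₁ h₂ h₁k h₂k →
    cong₂ F (ui h₁ (proj₁ (k⊆ _ h₁k))) (vj h₂ (proj₂ (k⊆ _ h₂k)))

  cocycle⇒additive : {c : C¹} → (∀ g h → ∂¹ c g h ≡ 0ₚ) →
    ∀ g h → c (g ∙ h) ≡ c g +ₚ c h
  cocycle⇒additive {c} ∂c≡0 g h = begin
    c (g ∙ h)                                    ≡⟨ solve 3 (λ x y z → z := (x :+ y) :- ((y :- z) :+ x)) ≡.refl (c g) (c h) (c (g ∙ h)) ⟩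
    (c g +ₚ c h) -ₚ ∂¹ c g h                     ≡⟨ cong (λ t → (c g +ₚ c h) -ₚ t) (∂c≡0 g h) ⟩
    (c g +ₚ c h) -ₚ 0ₚ                           ≡⟨ solve 2 (λ x y → (x :+ y) :- con (+ 0) := x :+ y) ≡.refl (c g) (c h) ⟩
    c g +ₚ c h                                   ∎

  -- A cocycle representing χ differs from χ by the coboundary of a
  -- 0-cochain, which vanishes for the trivial action.
  represents⇒≡ : {c : C¹} (χ : Z¹) → Represents c χ → ∀ g → c g ≡ fn χ g
  represents⇒≡ χ (_ , _ , a , c≡χ+∂a) g = trans (c≡χ+∂a g)
    (solve 2 (λ x a → x :+ (a :- a) := x) ≡.refl (fn χ g) a)

  ∂¹-+ : (c d : C¹) → ∀ g h → ∂¹ (λ x → c x +ₚ d x) g h ≡ ∂¹ c g h +ₚ ∂¹ d g h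
  ∂¹-+ c d g h = solve 6 (λ cg ch cgh dg dh dgh →
      ((ch :+ dh) :- (cgh :+ dgh)) :+ (cg :+ dg) := ((ch :- cgh) :+ cg) :+ ((dh :- dgh) :+ dg))
    ≡.refl (c g) (c h) (c (g ∙ h)) (d g) (d h) (d (g ∙ h))

  ∂¹-- : (c d : C¹) → ∀ g h → ∂¹ (λ x → c x -ₚ d x) g h ≡ ∂¹ c g h -ₚ ∂¹ d g h
  ∂¹-- c d g h = solve 6 (λ cg ch cgh dg dh dgh →
      ((ch :- dh) :- (cgh :- dgh)) :+ (cg :- dg) := ((ch :- cgh) :+ cg) :- ((dh :- dgh) :+ dg))
    ≡.refl (c g) (c h) (c (g ∙ h)) (d g) (d h) (d (g ∙ h))

  ∂¹-cocycle-invariant-+ : (c : C¹) (ψ : Z¹) → ∀ g h → ∂¹ (λ x → c x +ₚ fn ψ x) g h ≡ ∂¹ c g h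
  ∂¹-cocycle-invariant-+ c ψ g h = begin
    ∂¹ (λ x → c x +ₚ fn ψ x) g h   ≡⟨ ∂¹-+ c (fn ψ) g h ⟩
    ∂¹ c g h +ₚ ∂¹ (fn ψ) g h      ≡⟨ cong (∂¹ c g h +ₚ_) (cocycle ψ g h) ⟩
    ∂¹ c g h +ₚ 0ₚ                 ≡⟨ solve 1 (λ x → x :+ con (+ 0) := x) ≡.refl (∂¹ c g h) ⟩
    ∂¹ c g h                       ∎

  ∂¹-cocycle-invariant-- : (c : C¹) (ψ : Z¹) → ∀ g h → ∂¹ (λ x → c x -ₚ fn ψ x) g h ≡ ∂¹ c g h
  ∂¹-cocycle-invariant-- c ψ g h = begin
    ∂¹ (λ x → c x -ₚ fn ψ x) g h   ≡⟨ ∂¹-- c (fn ψ) g h ⟩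
    ∂¹ c g h -ₚ ∂¹ (fn ψ) g h      ≡⟨ cong (λ t → ∂¹ c g h -ₚ t) (cocycle ψ g h) ⟩
    ∂¹ c g h -ₚ 0ₚ                 ≡⟨ solve 1 (λ x → x :- con (+ 0) := x) ≡.refl (∂¹ c g h) ⟩
    ∂¹ c g h                       ∎

  ∂¹-product : (f k : C¹) → (∀ g h → f (g ∙ h) ≡ f g +ₚ f h) → (∀ g h → k (g ∙ h) ≡ k g +ₚ k h) →
    ∀ g h → ∂¹ (λ x → f x *ₚ k x) g h ≡ -ₚ (f g *ₚ k h +ₚ k g *ₚ f h)
  ∂¹-product f k f-additive k-additive g h = begin
    (f h *ₚ k h -ₚ f (g ∙ h) *ₚ k (g ∙ h)) +ₚ f g *ₚ k g
      ≡⟨ cong₂ (λ a b → (f h *ₚ k h -ₚ a *ₚ b) +ₚ f g *ₚ k g) (f-additive g h) (k-additive g h) ⟩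
    (f h *ₚ k h -ₚ (f g +ₚ f h) *ₚ (k g +ₚ k h)) +ₚ f g *ₚ k g
      ≡⟨ solve 4 (λ fg fh kg kh → (fh :* kh :- (fg :+ fh) :* (kg :+ kh)) :+ fg :* kg := :- (fg :* kh :+ kg :* fh))
           ≡.refl (f g) (f h) (k g) (k h) ⟩
    -ₚ (f g *ₚ k h +ₚ k g *ₚ f h) ∎

  -- Leibniz rule for the 2-cochain shape of a Massey product:
  -- ∂²(a ∪ b) = ∂¹a ∪ b - a ∪ ∂¹b.
  ∂²-leibniz : (a b c d : C¹) → ∀ g h k →
    ∂² (-ᶜ ((a ∪ b) +² (c ∪ d))) g h k
      ≡ -ₚ ((∂¹ a g h *ₚ b k -ₚ a g *ₚ ∂¹ b h k) +ₚ (∂¹ c g h *ₚ d k -ₚ c g *ₚ ∂¹ d h k))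
  ∂²-leibniz a b c d g h k =
    solve 12 (λ ag ah agh bh bk bhk cg ch cgh dh dk dhk →
      ((:- (ah :* bk :+ ch :* dk) :- :- (agh :* bk :+ cgh :* dk)) :+ :- (ag :* bhk :+ cg :* dhk))
        :- :- (ag :* bh :+ cg :* dh)
      := :- (((((ah :- agh) :+ ag) :* bk) :- ag :* ((bk :- bhk) :+ bh))
             :+ ((((ch :- cgh) :+ cg) :* dk) :- cg :* ((dk :- dhk) :+ dh))))
      ≡.refl (a g) (a h) (a (g ∙ h)) (b h) (b k) (b (h ∙ k)) (c g) (c h) (c (g ∙ h)) (d h) (d k) (d (h ∙ k))

  module _ {χ₁ χ₂ χ₃ : Z¹} (D : DefiningSystem χ₁ χ₂ χ₃) where
    open DefiningSystem D

    c̃₁₃-continuous : Cont² c̃₁₃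
    c̃₁₃-continuous = Cont²-separated (λ (a , b) (d , e) → -ₚ (a *ₚ d +ₚ b *ₚ e))
      (locallyConstant-pair (proj₁ rep₁) cont₁₂) (locallyConstant-pair cont₂₃ (proj₁ rep₃))

    -- ... and a cocycle: in the Leibniz rule the terms ∂c₁₁ = ∂c₃₃ = 0 drop
    -- out and the two remaining ones, c₁₁ ∪ c₂₂ ∪ c₃₃, cancel.
    c̃₁₃-cocycle : ∀ g h k → ∂² c̃₁₃ g h k ≡ 0ₚ
    c̃₁₃-cocycle g h k = trans (∂²-leibniz c₁₁ c₂₃ c₁₂ c₃₃ g h k)
      (cancellation (c₁₁ g) (c₂₂ h) (c₃₃ k) (c₂₃ k) (c₁₂ g)
        (proj₁ (proj₂ rep₁) g h) (∂c₂₃ h k) (∂c₁₂ g h) (proj₁ (proj₂ rep₃) h k))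
      where
      cancellation : ∀ {A B C E} a x y d c → A ≡ 0ₚ → B ≡ -ₚ (x *ₚ y) → C ≡ -ₚ (a *ₚ x) → E ≡ 0ₚ →
        -ₚ ((A *ₚ d -ₚ a *ₚ B) +ₚ (C *ₚ y -ₚ c *ₚ E)) ≡ 0ₚ
      cancellation a x y d c ≡.refl ≡.refl ≡.refl ≡.refl =
        solve 5 (λ a x y d c →
          :- ((con (+ 0) :* d :- a :* :- (x :* y)) :+ (:- (a :* x) :* y :- c :* con (+ 0))) := con (+ 0))
          ≡.refl a x y d c

    -- c₁₁ and c₃₃ agree with χ₁ and χ₃, so c̃₁₃ vanishes identically on
    -- K = Ker χ₁ ∩ Ker χ₃; hence it restricts to the coboundary of 0.
    c̃₁₃-restriction-trivial : ResTrivial χ₁ χ₃ c̃₁₃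
    c̃₁₃-restriction-trivial = (λ _ → 0ₚ) , (λ _ → inhabited , λ _ _ → ≡.refl) , vanishes
      where
      vanishes : ∀ (x y : K χ₁ χ₃) (xy : InK χ₁ χ₃ (proj₁ x ∙ proj₁ y)) →
        c̃₁₃ (proj₁ x) (proj₁ y) ≡ (0ₚ -ₚ 0ₚ) +ₚ 0ₚ
      vanishes (x , χ₁x≡0 , _) (y , _ , χ₃y≡0) _ = begin
        -ₚ (c₁₁ x *ₚ c₂₃ y +ₚ c₁₂ x *ₚ c₃₃ y)
          ≡⟨ cong₂ (λ a e → -ₚ (a *ₚ c₂₃ y +ₚ c₁₂ x *ₚ e))
               (trans (represents⇒≡ χ₁ rep₁ x) χ₁x≡0) (trans (represents⇒≡ χ₃ rep₃ y) χ₃y≡0) ⟩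
        -ₚ (0ₚ *ₚ c₂₃ y +ₚ c₁₂ x *ₚ 0ₚ)
          ≡⟨ solve 2 (λ d b → :- (con (+ 0) :* d :+ b :* con (+ 0)) := (con (+ 0) :- con (+ 0)) :+ con (+ 0))
               ≡.refl (c₂₃ y) (c₁₂ x) ⟩
        (0ₚ -ₚ 0ₚ) +ₚ 0ₚ ∎

    shift : (ψ₁ ψ₃ : Z¹) → DefiningSystem χ₁ χ₂ χ₃
    shift ψ₁ ψ₃ = record
      { c₁₁ = c₁₁ ; c₂₂ = c₂₂ ; c₃₃ = c₃₃
      ; c₁₂ = λ x → c₁₂ x -ₚ fn ψ₃ x
      ; c₂₃ = λ x → c₂₃ x +ₚ fn ψ₁ x
      ; rep₁ = rep₁ ; rep₂ = rep₂ ; rep₃ = rep₃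
      ; cont₁₂ = Cont¹-pointwise _-ₚ_ cont₁₂ (cont ψ₃)
      ; cont₂₃ = Cont¹-pointwise _+ₚ_ cont₂₃ (cont ψ₁)
      ; ∂c₁₂ = λ g h → trans (∂¹-cocycle-invariant-- c₁₂ ψ₃ g h) (∂c₁₂ g h)
      ; ∂c₂₃ = λ g h → trans (∂¹-cocycle-invariant-+ c₂₃ ψ₁ g h) (∂c₂₃ g h)
      }

    c̃₁₃-shift : (ψ₁ ψ₃ : Z¹) → ∀ g h →
      DefiningSystem.c̃₁₃ (shift ψ₁ ψ₃) g h ≡ (c̃₁₃ g h -ₚ c₁₁ g *ₚ fn ψ₁ h) +ₚ fn ψ₃ g *ₚ c₃₃ h
    c̃₁₃-shift ψ₁ ψ₃ g h =
      solve 6 (λ a d p₁ b p₃ e →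
        :- (a :* (d :+ p₁) :+ (b :- p₃) :* e) := (:- (a :* d :+ b :* e) :- a :* p₁) :+ p₃ :* e)
        ≡.refl (c₁₁ g) (c₂₃ h) (fn ψ₁ h) (c₁₂ g) (fn ψ₃ g) (c₃₃ h)

    -- If c̃₁₃ = χ₁ ∪ ψ₁ + χ₃ ∪ ψ₃ + ∂b, the system shifted by (ψ₁, ψ₃) has
    -- Massey cochain ∂b + χ₃ ∪ ψ₃ + ψ₃ ∪ χ₃ = ∂(b - χ₃·ψ₃), a coboundary.
    cupImage⇒zeroInMassey : InCupImage χ₁ χ₃ c̃₁₃ → ZeroInMassey χ₁ χ₂ χ₃
    cupImage⇒zeroInMassey (ψ₁ , ψ₃ , b , cont-b , c̃₁₃≡) = shift ψ₁ ψ₃ ,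
      (λ x → b x -ₚ χ₃ψ₃ x) , Cont¹-pointwise _-ₚ_ cont-b (Cont¹-pointwise _*ₚ_ (cont χ₃) (cont ψ₃)) , bounds
      where
      χ₃ψ₃ : C¹
      χ₃ψ₃ x = fn χ₃ x *ₚ fn ψ₃ x
      bounds : ∀ g h → DefiningSystem.c̃₁₃ (shift ψ₁ ψ₃) g h ≡ ∂¹ (λ x → b x -ₚ χ₃ψ₃ x) g h
      bounds g h = begin
        DefiningSystem.c̃₁₃ (shift ψ₁ ψ₃) g h
          ≡⟨ c̃₁₃-shift ψ₁ ψ₃ g h ⟩
        (c̃₁₃ g h -ₚ c₁₁ g *ₚ fn ψ₁ h) +ₚ fn ψ₃ g *ₚ c₃₃ h
          ≡⟨ cong (λ t → (t -ₚ c₁₁ g *ₚ fn ψ₁ h) +ₚ fn ψ₃ g *ₚ c₃₃ h) (c̃₁₃≡ g h) ⟩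
        ((fn χ₁ g *ₚ fn ψ₁ h +ₚ fn χ₃ g *ₚ fn ψ₃ h) +ₚ ∂¹ b g h -ₚ c₁₁ g *ₚ fn ψ₁ h) +ₚ fn ψ₃ g *ₚ c₃₃ h
          ≡⟨ cong₂ (λ a e → ((fn χ₁ g *ₚ fn ψ₁ h +ₚ fn χ₃ g *ₚ fn ψ₃ h) +ₚ ∂¹ b g h -ₚ a *ₚ fn ψ₁ h) +ₚ fn ψ₃ g *ₚ e)
               (represents⇒≡ χ₁ rep₁ g) (represents⇒≡ χ₃ rep₃ h) ⟩
        ((fn χ₁ g *ₚ fn ψ₁ h +ₚ fn χ₃ g *ₚ fn ψ₃ h) +ₚ ∂¹ b g h -ₚ fn χ₁ g *ₚ fn ψ₁ h) +ₚ fn ψ₃ g *ₚ fn χ₃ h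
          ≡⟨ cancel-χ₁ψ₁ (fn χ₁ g) (fn ψ₁ h) (fn χ₃ g) (fn ψ₃ h) (∂¹ b g h) (fn ψ₃ g) (fn χ₃ h) ⟩
        ∂¹ b g h -ₚ -ₚ (fn χ₃ g *ₚ fn ψ₃ h +ₚ fn ψ₃ g *ₚ fn χ₃ h)
          ≡⟨ cong (λ t → ∂¹ b g h -ₚ t) (∂¹-product (fn χ₃) (fn ψ₃) (additive χ₃) (additive ψ₃) g h) ⟨
        ∂¹ b g h -ₚ ∂¹ χ₃ψ₃ g h
          ≡⟨ ∂¹-- b χ₃ψ₃ g h ⟨
        ∂¹ (λ x → b x -ₚ χ₃ψ₃ x) g h ∎
        where
        cancel-χ₁ψ₁ : ∀ x₁ y₁ x₃ y₃ β y₃′ x₃′ →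
          ((x₁ *ₚ y₁ +ₚ x₃ *ₚ y₃) +ₚ β -ₚ x₁ *ₚ y₁) +ₚ y₃′ *ₚ x₃′ ≡ β -ₚ -ₚ (x₃ *ₚ y₃ +ₚ y₃′ *ₚ x₃′)
        cancel-χ₁ψ₁ = solve 7 (λ x₁ y₁ x₃ y₃ β y₃′ x₃′ →
          ((x₁ :* y₁ :+ x₃ :* y₃) :+ β :- x₁ :* y₁) :+ y₃′ :* x₃′ := β :- :- (x₃ :* y₃ :+ y₃′ :* x₃′)) ≡.refl
        additive : (χ : Z¹) → ∀ g h → fn χ (g ∙ h) ≡ fn χ g +ₚ fn χ h
        additive χ = cocycle⇒additive (cocycle χ)

  zeroInMassey : (χ₁ χ₂ χ₃ : Z¹) → MasseyDefined χ₁ χ₂ χ₃ → CupResProperty χ₁ χ₃ → ZeroInMassey χ₁ χ₂ χ₃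
  zeroInMassey χ₁ χ₂ χ₃ D cupRes = cupImage⇒zeroInMassey D
    (proj₁ (cupRes c̃₁₃ (c̃₁₃-continuous D) (c̃₁₃-cocycle D)) (c̃₁₃-restriction-trivial D))
    where open DefiningSystem D using (c̃₁₃)

proposition6p2 : (p : ℕ) (pp : Prime p) (G : ProfiniteGroup)
    (χ₁ χ₂ χ₃ : Cochains.Z¹ p pp G) →
    Cochains.MasseyDefined p pp G χ₁ χ₂ χ₃ →
    Cochains.CupResProperty p pp G χ₁ χ₃ →
    Cochains.ZeroInMassey p pp G χ₁ χ₂ χ₃
proposition6p2 p pp G = MasseyVanishing.zeroInMassey p pp G
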